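{- Let $\mathcal{M}=\langle Q,A,\delta\rangle$ be an MDP, let $\alpha$ be the smallest positive probability in the transitions of $\mathcal{M}$, let $T\subseteq Q$, and let $d_0$ be an initial distribution with smallest positive probability $\alpha_0=\min\{d_0(q)\mid q\in\mathrm{Supp}(d_0)\}$. If $d_0$ is not sure eventually synchronizing in $T$ (i.e. there is no strategy $\sigma$ and index $i\ge 0$ with $\mathcal{M}^{\sigma}_i(T)=1$), then for all strategies $\sigma$ and all $i\ge 0$, $$\mathcal{M}^{\sigma}_i(T)\le 1-\alpha_0\cdot\alpha^{i}.$$
   Context: An MDP is $\mathcal{M}=\langle Q,A,\delta\rangle$ with $Q$ finite set of states, $A$ finite set of actions, $\delta:Q\times A\to\mathcal{D}(Q)$ probabilistic transition function ($\mathcal{D}(Q)$ = probability distributions on $Q$). A (randomized) strategy is a function $\sigma:(QA)^*Q\to\mathcal{D}(A)$; with an initial distribution $d_0$ it induces a probability measure $\Pr^{\sigma}_{d_0}$ on infinite paths in the standard way (a finite path $q_0a_0\dots q_k$ has probability $d_0(q_0)\prod_{j<k}\sigma(q_0a_0\dots q_j)(a_j)\delta(q_j,a_j)(q_{j+1})$). The distribution after $i$ steps is $\mathcal{M}^{\sigma}_i(q)=\Pr^{\sigma}_{d_0}(\text{the state at position } i \text{ is } q)$, so $\mathcal{M}^{\sigma}_0=d_0$; for $T\subseteq Q$, $d(T)=\sum_{q\in T}d(q)$.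
   Formalization: The transition probabilities δ, the initial distribution $d_0$ and the randomized strategies σ take values in the rationals. -}

module Defs where

open import Data.Nat using (ℕ; zero; suc)
open import Data.Fin using (Fin; zero; suc)
open import Data.Fin.Subset using (Subset)
open import Data.Fin.Subset.Properties using (_∈?_)
open import Data.Rational using (ℚ; 0ℚ; 1ℚ; _+_; _*_; _≤_; _<_)
open import Data.List using (List; []; _∷_; reverse; concatMap; map; allFin)
open import Data.Product using (_×_; _,_; Σ)
open import Relation.Nullary using (does)
open import Data.Bool using (if_then_else_)
open import Relation.Binary.PropositionalEquality using (_≡_)

_^ℚ_ : ℚ → ℕ → ℚ
x ^ℚ zero  = 1ℚ
x ^ℚ suc k = x * (x ^ℚ k)

sumFin : ∀ {k} → (Fin k → ℚ) → ℚ
sumFin {zero}  f = 0ℚ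
sumFin {suc k} f = f zero + sumFin (λ i → f (suc i))

sumList : List ℚ → ℚ
sumList []       = 0ℚ
sumList (x ∷ xs) = x + sumList xs

IsDist : ∀ {k} → (Fin k → ℚ) → Set
IsDist f = (∀ i → 0ℚ ≤ f i) × (sumFin f ≡ 1ℚ)

record MDP (n m : ℕ) : Set where
  field
    δ      : Fin n → Fin m → Fin n → ℚ
    δ-dist : ∀ q a → IsDist (δ q a)
open MDP public

-- randomized strategy: history (q0 a0 ... q_{k-1} a_{k-1}) in chronological order,
-- plus current state q_k, gives a distribution over actions
record Strategy (n m : ℕ) : Set where
  field
    σ      : List (Fin n × Fin m) → Fin n → Fin m → ℚ
    σ-dist : ∀ h q → IsDist (σ h q)
open Strategy public

-- all histories of length i, stored in REVERSE order (most recent pair first)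
revHists : ∀ {n m} → ℕ → List (List (Fin n × Fin m))
revHists zero    = [] ∷ []
revHists {n} {m} (suc i) =
  concatMap (λ h → concatMap (λ p → map (λ a → (p , a) ∷ h) (allFin m)) (allFin n))
            (revHists {n} {m} i)

-- probability of the finite path  (reverse h) followed by state q
pathProb : ∀ {n m} → MDP n m → (Fin n → ℚ) → Strategy n m →
           List (Fin n × Fin m) → Fin n → ℚ
pathProb M d₀ S []            q = d₀ q
pathProb M d₀ S ((p , a) ∷ h) q =
  pathProb M d₀ S h p * σ S (reverse h) p a * δ M p a q

distAt : ∀ {n m} → MDP n m → (Fin n → ℚ) → Strategy n m → ℕ → Fin n → ℚ
distAt {n} {m} M d₀ S i q = sumList (map (λ h → pathProb M d₀ S h q) (revHists {n} {m} i))

mass : ∀ {n} → (Fin n → ℚ) → Subset n → ℚ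
mass d T = sumFin (λ q → if does (q ∈? T) then d q else 0ℚ)

IsMinPosTrans : ∀ {n m} → MDP n m → ℚ → Set
IsMinPosTrans {n} {m} M α =
  (0ℚ < α) ×
  (Σ (Fin n) λ p → Σ (Fin m) λ a → Σ (Fin n) λ q → δ M p a q ≡ α) ×
  (∀ p a q → 0ℚ < δ M p a q → α ≤ δ M p a q)

IsMinPos : ∀ {n} → (Fin n → ℚ) → ℚ → Set
IsMinPos {n} d α₀ =
  (0ℚ < α₀) × (Σ (Fin n) λ q → d q ≡ α₀) × (∀ q → 0ℚ < d q → α₀ ≤ d q)

SureEventuallySync : ∀ {n m} → MDP n m → Subset n → (Fin n → ℚ) → Set
SureEventuallySync {n} {m} M T d₀ =
  Σ (Strategy n m) λ S → Σ ℕ λ i → mass (distAt M d₀ S i) T ≡ 1ℚ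

{-# OPTIONS --safe #-}
-- Let Pre X be the set of states having an action all of whose successors lie in X, so that
-- Pre^ k T is where some strategy reaches T surely in exactly k steps. Against any strategy,
-- from a state outside Pre (Pre^ k T) every action leaves Pre^ k T with probability at least α;
-- hence the mass lying outside Pre^ k T at step j is at least α^j times the initial mass outside
-- Pre^ (j + k) T, and at step i the mass outside T is at least α₀ α^i as soon as some state of
-- Supp d₀ lies outside Pre^ i T. Otherwise Supp d₀ ⊆ Pre^ i T, and the strategy that at step j
-- plays an action keeping the play inside Pre^ (i ∸ (j + 1)) T puts all the mass in T at step i.

module Submission where

open import Defs
open import Data.Nat using (ℕ; zero; suc; _∸_) renaming (_+_ to _+ℕ_)
import Data.Nat.Properties as ℕ
open import Data.Fin using (Fin; zero; suc; _≟_)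
open import Data.Fin.Subset using (Subset)
open import Data.Fin.Subset.Properties using (_∈?_)
open import Data.Fin.Properties using (any?; all?; ¬∀⟶∃¬)
open import Data.Rational using (ℚ; 0ℚ; 1ℚ; _-_; _+_; _*_; _≤_; _<_; -_; nonNegative)
open import Data.Rational.Properties hiding (_≟_)
open import Data.List using (List; []; _∷_; _++_; map; concatMap; allFin; length; reverse)
open import Data.List.Properties using (map-tabulate; map-∘; length-reverse)
open import Data.List.Membership.Propositional using (_∈_)
open import Data.List.Membership.Propositional.Properties using (∈-allFin)
open import Data.List.Relation.Unary.Any using (here; there)
open import Data.List.Relation.Unary.All as All using (All; []; _∷_; universal)
open import Data.List.Relation.Unary.All.Properties using (concat⁺; map⁺)
open import Data.Bool using (Bool; true; false; not; if_then_else_)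
open import Data.Bool.Properties using (¬-not) renaming (_≟_ to _≟ᴮ_)
open import Data.Product using (_×_; _,_; ∃; proj₁; proj₂)
open import Data.Sum using (_⊎_; inj₁; inj₂)
open import Data.Empty using (⊥-elim)
open import Function using (_∘_)
open import Relation.Nullary using (¬_; Dec; yes; no; does; contradiction)
open import Relation.Nullary.Decidable using (_×-dec_; _⊎-dec_)
open import Relation.Binary.PropositionalEquality
open import Algebra.Bundles using (CommutativeMonoid)
open import Algebra.Properties.CommutativeSemigroup
  (CommutativeMonoid.commutativeSemigroup +-0-commutativeMonoid) using () renaming (interchange to +-interchange)
open import Algebra.Properties.CommutativeSemigroup
  (CommutativeMonoid.commutativeSemigroup *-1-commutativeMonoid) using () renaming (x∙yz≈y∙xz to *-leftComm)

private variable
  A B : Set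
  k n m : ℕ

-- Through sumList, so that distAt M d₀ S j q is definitionally ∑[ h ∈ revHists j ] pathProb M d₀ S h q.
∑ : List A → (A → ℚ) → ℚ
∑ xs f = sumList (map f xs)

syntax ∑ xs (λ x → e) = ∑[ x ∈ xs ] e

∑-cong : (xs : List A) {f g : A → ℚ} → (∀ x → f x ≡ g x) → ∑ xs f ≡ ∑ xs g
∑-cong []       f≗g = refl
∑-cong (x ∷ xs) f≗g = cong₂ _+_ (f≗g x) (∑-cong xs f≗g)

∑-zero : (xs : List A) {f : A → ℚ} → (∀ x → f x ≡ 0ℚ) → ∑ xs f ≡ 0ℚ
∑-zero []       f≗0 = refl
∑-zero (x ∷ xs) f≗0 = trans (cong₂ _+_ (f≗0 x) (∑-zero xs f≗0)) (+-identityˡ 0ℚ)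

∑-++ : (xs ys : List A) (f : A → ℚ) → ∑ (xs ++ ys) f ≡ ∑ xs f + ∑ ys f
∑-++ []       ys f = sym (+-identityˡ _)
∑-++ (x ∷ xs) ys f = trans (cong (f x +_) (∑-++ xs ys f)) (sym (+-assoc (f x) _ _))

∑-concatMap : (g : A → List B) (xs : List A) (f : B → ℚ) →
              ∑ (concatMap g xs) f ≡ ∑[ x ∈ xs ] ∑ (g x) f
∑-concatMap g []       f = refl
∑-concatMap g (x ∷ xs) f =
  trans (∑-++ (g x) (concatMap g xs) f) (cong (∑ (g x) f +_) (∑-concatMap g xs f))

∑-map : (g : A → B) (xs : List A) (f : B → ℚ) → ∑ (map g xs) f ≡ ∑ xs (f ∘ g)
∑-map g xs f = cong sumList (sym (map-∘ xs))

∑-+ : (xs : List A) (f g : A → ℚ) → ∑[ x ∈ xs ] (f x + g x) ≡ ∑ xs f + ∑ xs g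
∑-+ []       f g = sym (+-identityˡ 0ℚ)
∑-+ (x ∷ xs) f g =
  trans (cong ((f x + g x) +_) (∑-+ xs f g)) (+-interchange (f x) (g x) (∑ xs f) (∑ xs g))

∑-*ˡ : (xs : List A) (c : ℚ) (f : A → ℚ) → ∑[ x ∈ xs ] (c * f x) ≡ c * ∑ xs f
∑-*ˡ []       c f = sym (*-zeroʳ c)
∑-*ˡ (x ∷ xs) c f = trans (cong (c * f x +_) (∑-*ˡ xs c f)) (sym (*-distribˡ-+ c (f x) _))

∑-*ʳ : (xs : List A) (c : ℚ) (f : A → ℚ) → ∑[ x ∈ xs ] (f x * c) ≡ ∑ xs f * c
∑-*ʳ xs c f = trans (∑-cong xs (λ x → *-comm (f x) c)) (trans (∑-*ˡ xs c f) (*-comm c _))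

∑-comm : (xs : List A) (ys : List B) (F : A → B → ℚ) →
         ∑[ x ∈ xs ] ∑ ys (F x) ≡ ∑[ y ∈ ys ] ∑[ x ∈ xs ] F x y
∑-comm []       ys F = sym (∑-zero ys (λ _ → refl))
∑-comm (x ∷ xs) ys F =
  trans (cong (∑ ys (F x) +_) (∑-comm xs ys F)) (sym (∑-+ ys (F x) _))

∑-mono : (xs : List A) {f g : A → ℚ} → All (λ x → f x ≤ g x) xs → ∑ xs f ≤ ∑ xs g
∑-mono []       []            = ≤-refl
∑-mono (x ∷ xs) (fx≤gx ∷ f≤g) = +-mono-≤ fx≤gx (∑-mono xs f≤g)

∑-nonneg : (xs : List A) {f : A → ℚ} → (∀ x → 0ℚ ≤ f x) → 0ℚ ≤ ∑ xs f
∑-nonneg xs f≥0 = ≤-trans (≤-reflexive (sym (∑-zero xs (λ _ → refl)))) (∑-mono xs (universal f≥0 xs))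

∈⇒≤∑ : {xs : List A} {f : A → ℚ} → (∀ x → 0ℚ ≤ f x) → ∀ {x} → x ∈ xs → f x ≤ ∑ xs f
∈⇒≤∑ {xs = x ∷ xs} {f} f≥0 (here refl) =
  ≤-trans (≤-reflexive (sym (+-identityʳ (f x)))) (+-monoʳ-≤ (f x) (∑-nonneg xs f≥0))
∈⇒≤∑ {xs = y ∷ xs} {f} f≥0 (there x∈xs) =
  ≤-trans (∈⇒≤∑ f≥0 x∈xs)
    (≤-trans (≤-reflexive (sym (+-identityˡ (∑ xs f)))) (+-monoˡ-≤ (∑ xs f) (f≥0 y)))

∑-allFin-suc : (f : Fin (suc k) → ℚ) → ∑ (allFin (suc k)) f ≡ f zero + ∑ (allFin k) (f ∘ suc)
∑-allFin-suc f = cong (λ xs → f zero + sumList xs)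
  (trans (map-tabulate suc f) (sym (map-tabulate (λ i → i) (f ∘ suc))))

sumFin≡∑ : (f : Fin k → ℚ) → sumFin f ≡ ∑ (allFin k) f
sumFin≡∑ {zero}  f = refl
sumFin≡∑ {suc k} f = trans (cong (f zero +_) (sumFin≡∑ (f ∘ suc))) (sym (∑-allFin-suc f))

*-nonneg : ∀ {p q} → 0ℚ ≤ p → 0ℚ ≤ q → 0ℚ ≤ p * q
*-nonneg {p} {q} p≥0 q≥0 =
  nonNegative⁻¹ _ {{nonNeg*nonNeg⇒nonNeg p {{nonNegative p≥0}} q {{nonNegative q≥0}}}}

*-monoˡ-≤-0≤ : ∀ {p q r} → 0ℚ ≤ p → q ≤ r → p * q ≤ p * r
*-monoˡ-≤-0≤ {p} p≥0 = *-monoˡ-≤-nonNeg p {{nonNegative p≥0}}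

^ℚ-nonneg : ∀ {p} → 0ℚ ≤ p → ∀ j → 0ℚ ≤ p ^ℚ j
^ℚ-nonneg p≥0 zero    = nonNegative⁻¹ 1ℚ
^ℚ-nonneg p≥0 (suc j) = *-nonneg p≥0 (^ℚ-nonneg p≥0 j)

𝟙 : Bool → ℚ
𝟙 true  = 1ℚ
𝟙 false = 0ℚ

𝟙-nonneg : ∀ b → 0ℚ ≤ 𝟙 b
𝟙-nonneg true  = nonNegative⁻¹ 1ℚ
𝟙-nonneg false = ≤-refl

expect : (Fin k → ℚ) → (Fin k → ℚ) → ℚ
expect {k} μ w = ∑[ i ∈ allFin k ] (μ i * w i)

expect-cong : (μ : Fin k → ℚ) {w w′ : Fin k → ℚ} → (∀ i → w i ≡ w′ i) → expect μ w ≡ expect μ w′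
expect-cong {k} μ w≗w′ = ∑-cong (allFin k) (λ i → cong (μ i *_) (w≗w′ i))

expect-scaleˡ : (c : ℚ) (μ w : Fin k → ℚ) → expect (λ i → c * μ i) w ≡ c * expect μ w
expect-scaleˡ {k} c μ w =
  trans (∑-cong (allFin k) (λ i → *-assoc c (μ i) (w i))) (∑-*ˡ (allFin k) c _)

module _ {μ : Fin k → ℚ} where

  expect-mono : (∀ i → 0ℚ ≤ μ i) → {w w′ : Fin k → ℚ} → (∀ i → w i ≤ w′ i) →
                expect μ w ≤ expect μ w′
  expect-mono μ≥0 w≤w′ = ∑-mono (allFin k) (universal (λ i → *-monoˡ-≤-0≤ (μ≥0 i) (w≤w′ i)) _)

  expect-*ˡ : (c : ℚ) (w : Fin k → ℚ) → expect μ (λ i → c * w i) ≡ c * expect μ w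
  expect-*ˡ c w = trans (∑-cong (allFin k) (λ i → *-leftComm (μ i) c (w i))) (∑-*ˡ (allFin k) c _)

  expect-const : IsDist μ → (c : ℚ) → expect μ (λ _ → c) ≡ c
  expect-const (_ , ∑μ≡1) c = begin
    ∑[ i ∈ allFin k ] (μ i * c)  ≡⟨ ∑-cong (allFin k) (λ i → *-comm (μ i) c) ⟩
    ∑[ i ∈ allFin k ] (c * μ i)  ≡⟨ ∑-*ˡ (allFin k) c μ ⟩
    c * ∑ (allFin k) μ           ≡⟨ cong (c *_) (trans (sym (sumFin≡∑ μ)) ∑μ≡1) ⟩
    c * 1ℚ                       ≡⟨ *-identityʳ c ⟩
    c                            ∎
    where open ≡-Reasoning

  expect-≤ : IsDist μ → ∀ {w c} → (∀ i → w i ≤ c) → expect μ w ≤ c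
  expect-≤ μ-dist {c = c} w≤c =
    ≤-trans (expect-mono (proj₁ μ-dist) w≤c) (≤-reflexive (expect-const μ-dist c))

  expect-≥ : IsDist μ → ∀ {w c} → (∀ i → c ≤ w i) → c ≤ expect μ w
  expect-≥ μ-dist {c = c} c≤w =
    ≤-trans (≤-reflexive (sym (expect-const μ-dist c))) (expect-mono (proj₁ μ-dist) c≤w)

  expect-≥-term : (∀ i → 0ℚ ≤ μ i) → {w : Fin k → ℚ} → (∀ i → 0ℚ ≤ w i) →
                  ∀ i → μ i * w i ≤ expect μ w
  expect-≥-term μ≥0 w≥0 i = ∈⇒≤∑ (λ j → *-nonneg (μ≥0 j) (w≥0 j)) (∈-allFin i)

  expect-vanishing : {w : Fin k → ℚ} → (∀ i → μ i ≡ 0ℚ ⊎ w i ≡ 0ℚ) → expect μ w ≡ 0ℚ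
  expect-vanishing {w} μ∨w≡0 = ∑-zero (allFin k) term≡0
    where
    term≡0 : ∀ i → μ i * w i ≡ 0ℚ
    term≡0 i with μ∨w≡0 i
    ... | inj₁ μi≡0 = trans (cong (_* w i) μi≡0) (*-zeroˡ (w i))
    ... | inj₂ wi≡0 = trans (cong (μ i *_) wi≡0) (*-zeroʳ (μ i))

pointMass : Fin k → Fin k → ℚ
pointMass a b = 𝟙 (does (b ≟ a))

expect-pointMass : (a : Fin k) (w : Fin k → ℚ) → expect (pointMass a) w ≡ w a
expect-pointMass {suc k} zero w = begin
  expect (pointMass zero) w
    ≡⟨ ∑-allFin-suc (λ b → pointMass zero b * w b) ⟩
  1ℚ * w zero + ∑[ b ∈ allFin k ] (0ℚ * w (suc b))
    ≡⟨ cong₂ _+_ (*-identityˡ (w zero)) (∑-zero (allFin k) (λ b → *-zeroˡ (w (suc b)))) ⟩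
  w zero + 0ℚ
    ≡⟨ +-identityʳ (w zero) ⟩
  w zero
    ∎
  where open ≡-Reasoning
expect-pointMass {suc k} (suc a) w = begin
  expect (pointMass (suc a)) w
    ≡⟨ ∑-allFin-suc (λ b → pointMass (suc a) b * w b) ⟩
  0ℚ * w zero + expect (pointMass a) (w ∘ suc)
    ≡⟨ cong₂ _+_ (*-zeroˡ (w zero)) (expect-pointMass a (w ∘ suc)) ⟩
  0ℚ + w (suc a)
    ≡⟨ +-identityˡ (w (suc a)) ⟩
  w (suc a)
    ∎
  where open ≡-Reasoning

pointMass-isDist : (a : Fin k) → IsDist (pointMass a)
pointMass-isDist {k} a = (λ b → 𝟙-nonneg (does (b ≟ a))) , (begin
  sumFin (pointMass a)             ≡⟨ sumFin≡∑ (pointMass a) ⟩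
  ∑ (allFin k) (pointMass a)       ≡⟨ ∑-cong (allFin k) (λ b → sym (*-identityʳ (pointMass a b))) ⟩
  expect (pointMass a) (λ _ → 1ℚ)  ≡⟨ expect-pointMass a _ ⟩
  1ℚ                               ∎)
  where open ≡-Reasoning

IsDist-inhabited : {μ : Fin k → ℚ} → IsDist μ → Fin k
IsDist-inhabited {zero}  (_ , ∑μ≡1) = ⊥-elim (1≢0 (sym ∑μ≡1))
IsDist-inhabited {suc k} _          = zero

_∈ᵇ_ : Fin n → Subset n → Bool
q ∈ᵇ T = does (q ∈? T)

𝟙ᶜ : (Fin n → Bool) → Fin n → ℚ
𝟙ᶜ X q = 𝟙 (not (X q))

𝟙ᶜ-nonneg : (X : Fin n → Bool) → ∀ q → 0ℚ ≤ 𝟙ᶜ X q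
𝟙ᶜ-nonneg X q = 𝟙-nonneg (not (X q))

𝟙ᶜ-true : (X : Fin n → Bool) {q : Fin n} → X q ≡ true → 𝟙ᶜ X q ≡ 0ℚ
𝟙ᶜ-true X q∈X = cong (𝟙 ∘ not) q∈X

𝟙ᶜ-false : (X : Fin n → Bool) {q : Fin n} → X q ≡ false → 𝟙ᶜ X q ≡ 1ℚ
𝟙ᶜ-false X q∉X = cong (𝟙 ∘ not) q∉X

𝟙ᶜ-≤1 : (X : Fin n → Bool) → ∀ q → 𝟙ᶜ X q ≤ 1ℚ
𝟙ᶜ-≤1 X q with X q
... | true  = nonNegative⁻¹ 1ℚ
... | false = ≤-refl

mass+expect-𝟙ᶜ : (d : Fin n → ℚ) (T : Subset n) → mass d T + expect d (𝟙ᶜ (_∈ᵇ T)) ≡ sumFin d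
mass+expect-𝟙ᶜ {n} d T = begin
  mass d T + expect d (𝟙ᶜ (_∈ᵇ T))                 ≡⟨ cong (_+ expect d (𝟙ᶜ (_∈ᵇ T))) (sumFin≡∑ inside) ⟩
  ∑ (allFin n) inside + expect d (𝟙ᶜ (_∈ᵇ T))      ≡⟨ sym (∑-+ (allFin n) inside _) ⟩
  ∑[ q ∈ allFin n ] (inside q + d q * 𝟙ᶜ (_∈ᵇ T) q) ≡⟨ ∑-cong (allFin n) (λ q → split (q ∈ᵇ T) (d q)) ⟩
  ∑ (allFin n) d                                   ≡⟨ sym (sumFin≡∑ d) ⟩
  sumFin d                                         ∎
  where
  open ≡-Reasoning
  inside : Fin n → ℚ
  inside q = if q ∈ᵇ T then d q else 0ℚ
  split : ∀ b x → (if b then x else 0ℚ) + x * 𝟙 (not b) ≡ x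
  split true  x = trans (cong (x +_) (*-zeroʳ x)) (+-identityʳ x)
  split false x = trans (+-identityˡ _) (*-identityʳ x)

module _ {d : Fin n → ℚ} (d-dist : IsDist d) (T : Subset n) where

  mass+expect-𝟙ᶜ≡1 : mass d T + expect d (𝟙ᶜ (_∈ᵇ T)) ≡ 1ℚ
  mass+expect-𝟙ᶜ≡1 = trans (mass+expect-𝟙ᶜ d T) (proj₂ d-dist)

  mass-≤ : ∀ {c} → c ≤ expect d (𝟙ᶜ (_∈ᵇ T)) → mass d T ≤ 1ℚ - c
  mass-≤ {c} c≤E = begin
    mass d T                ≡⟨ a≡a+b-b ⟩
    (mass d T + E) - E      ≡⟨ cong (_- E) mass+expect-𝟙ᶜ≡1 ⟩
    1ℚ - E                  ≤⟨ +-monoʳ-≤ 1ℚ (neg-antimono-≤ c≤E) ⟩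
    1ℚ - c                  ∎
    where
    open ≤-Reasoning
    E : ℚ
    E = expect d (𝟙ᶜ (_∈ᵇ T))
    a≡a+b-b : mass d T ≡ (mass d T + E) - E
    a≡a+b-b = sym (trans (+-assoc (mass d T) E (- E))
                         (trans (cong (mass d T +_) (+-inverseʳ E)) (+-identityʳ (mass d T))))

  mass-≡1 : expect d (𝟙ᶜ (_∈ᵇ T)) ≡ 0ℚ → mass d T ≡ 1ℚ
  mass-≡1 E≡0 = trans (sym (+-identityʳ (mass d T))) (trans (cong (mass d T +_) (sym E≡0)) mass+expect-𝟙ᶜ≡1)

History : ℕ → ℕ → Set
History n m = List (Fin n × Fin m)

-- revHists (suc j) is definitionally concatMap extensions (revHists j).
extensions : History n m → List (History n m)
extensions {n} {m} h = concatMap (λ p → map (λ a → (p , a) ∷ h) (allFin m)) (allFin n)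

revHists-length : ∀ j → All (λ h → length h ≡ j) (revHists {n} {m} j)
revHists-length zero    = refl ∷ []
revHists-length {n} {m} (suc j) = concat⁺ (map⁺ (All.map extensions-length (revHists-length j)))
  where
  extensions-length : ∀ {h} → length h ≡ j → All (λ h′ → length h′ ≡ suc j) (extensions h)
  extensions-length len =
    concat⁺ (map⁺ (universal (λ p → map⁺ (universal (λ a → cong suc len) (allFin m))) (allFin n)))

module _ {n m : ℕ} (M : MDP n m) where

  δ-nonneg : ∀ p a q → 0ℚ ≤ δ M p a q
  δ-nonneg p a = proj₁ (δ-dist M p a)

  -- δ ≤ 0 rather than δ ≡ 0, so that a failure of Supp⊆ yields 0 < δ, as the bound α needs.
  Supp⊆ : (Fin n → Bool) → Fin n → Fin m → Set
  Supp⊆ X p a = ∀ q → X q ≡ true ⊎ δ M p a q ≤ 0ℚ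

  supp⊆-at? : (X : Fin n → Bool) (p : Fin n) (a : Fin m) (q : Fin n) → Dec (X q ≡ true ⊎ δ M p a q ≤ 0ℚ)
  supp⊆-at? X p a q = (X q ≟ᴮ true) ⊎-dec (δ M p a q ≤? 0ℚ)

  supp⊆? : (X : Fin n → Bool) (p : Fin n) (a : Fin m) → Dec (Supp⊆ X p a)
  supp⊆? X p a = all? (supp⊆-at? X p a)

  Pre : (Fin n → Bool) → Fin n → Bool
  Pre X p = does (any? (supp⊆? X p))

  Pre^ : ℕ → (Fin n → Bool) → Fin n → Bool
  Pre^ zero    X = X
  Pre^ (suc k) X = Pre (Pre^ k X)

  Pre^-suc : ∀ k X → Pre^ (suc k) X ≡ Pre^ k (Pre X)
  Pre^-suc zero    X = refl
  Pre^-suc (suc k) X = cong Pre (Pre^-suc k X)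

  preferredAction : Fin m → (Fin n → Bool) → Fin n → Fin m
  preferredAction a₀ X p with any? (supp⊆? X p)
  ... | yes (a , _) = a
  ... | no _        = a₀

  preferredAction-supp⊆ : ∀ a₀ X p → Pre X p ≡ true → Supp⊆ X p (preferredAction a₀ X p)
  preferredAction-supp⊆ a₀ X p p∈Pre with any? (supp⊆? X p)
  ... | yes (_ , supp⊆) = supp⊆

  Pre-false : ∀ X p → Pre X p ≡ false → ∀ a → ∃ λ q → X q ≡ false × 0ℚ < δ M p a q
  Pre-false X p p∉Pre a with any? (supp⊆? X p)
  ... | no ¬supp⊆ with ¬∀⟶∃¬ n _ (supp⊆-at? X p a) (λ supp⊆ → ¬supp⊆ (a , supp⊆))
  ...   | q , q∉X⊎δ≤0 = q , ¬-not (q∉X⊎δ≤0 ∘ inj₁) , ≰⇒> (q∉X⊎δ≤0 ∘ inj₂)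

  step : Strategy n m → History n m → Fin n → (Fin n → ℚ) → ℚ
  step S h p w = expect (σ S (reverse h) p) (λ a → expect (δ M p a) w)

  step-const : ∀ S h p c → step S h p (λ _ → c) ≡ c
  step-const S h p c =
    trans (expect-cong (σ S (reverse h) p) (λ a → expect-const (δ-dist M p a) c))
          (expect-const (σ-dist S (reverse h) p) c)

  step-≤ : ∀ S h p {w c} → (∀ q → w q ≤ c) → step S h p w ≤ c
  step-≤ S h p w≤c = expect-≤ (σ-dist S (reverse h) p) (λ a → expect-≤ (δ-dist M p a) w≤c)

  step-≥ : ∀ S h p {w c} → (∀ q → c ≤ w q) → c ≤ step S h p w
  step-≥ S h p c≤w = expect-≥ (σ-dist S (reverse h) p) (λ a → expect-≥ (δ-dist M p a) c≤w)

  module _ (d₀ : Fin n → ℚ) (S : Strategy n m) where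

    ∑-extensions : ∀ h w → ∑[ h′ ∈ extensions h ] expect (pathProb M d₀ S h′) w
                           ≡ expect (pathProb M d₀ S h) (λ p → step S h p w)
    ∑-extensions h w = begin
      ∑[ h′ ∈ extensions h ] expect (P h′) w
        ≡⟨ ∑-concatMap _ (allFin n) _ ⟩
      ∑[ p ∈ allFin n ] ∑[ h′ ∈ map (λ a → (p , a) ∷ h) (allFin m) ] expect (P h′) w
        ≡⟨ ∑-cong (allFin n) (λ p → ∑-map _ (allFin m) _) ⟩
      ∑[ p ∈ allFin n ] ∑[ a ∈ allFin m ] expect (λ q → (P h p * σ′ p a) * δ M p a q) w
        ≡⟨ ∑-cong (allFin n) (λ p → ∑-cong (allFin m) (λ a →
             trans (expect-scaleˡ (P h p * σ′ p a) (δ M p a) w) (*-assoc (P h p) (σ′ p a) _))) ⟩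
      ∑[ p ∈ allFin n ] ∑[ a ∈ allFin m ] (P h p * (σ′ p a * expect (δ M p a) w))
        ≡⟨ ∑-cong (allFin n) (λ p → ∑-*ˡ (allFin m) (P h p) _) ⟩
      expect (P h) (λ p → step S h p w)
        ∎
      where
      open ≡-Reasoning
      P : History n m → Fin n → ℚ
      P = pathProb M d₀ S
      σ′ : Fin n → Fin m → ℚ
      σ′ = σ S (reverse h)

    expect-distAt : ∀ j w → expect (distAt M d₀ S j) w ≡ ∑[ h ∈ revHists j ] expect (pathProb M d₀ S h) w
    expect-distAt j w = begin
      ∑[ q ∈ allFin n ] (∑[ h ∈ revHists j ] P h q * w q)
        ≡⟨ ∑-cong (allFin n) (λ q → sym (∑-*ʳ (revHists j) (w q) (λ h → P h q))) ⟩
      ∑[ q ∈ allFin n ] ∑[ h ∈ revHists j ] (P h q * w q)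
        ≡⟨ ∑-comm (allFin n) (revHists j) _ ⟩
      ∑[ h ∈ revHists j ] expect (P h) w
        ∎
      where
      open ≡-Reasoning
      P : History n m → Fin n → ℚ
      P = pathProb M d₀ S

    expect-distAt-zero : ∀ w → expect (distAt M d₀ S 0) w ≡ expect d₀ w
    expect-distAt-zero w = trans (expect-distAt 0 w) (+-identityʳ (expect d₀ w))

    expect-distAt-suc : ∀ j w → expect (distAt M d₀ S (suc j)) w
                                ≡ ∑[ h ∈ revHists j ] expect (pathProb M d₀ S h) (λ p → step S h p w)
    expect-distAt-suc j w = begin
      expect (distAt M d₀ S (suc j)) w                              ≡⟨ expect-distAt (suc j) w ⟩
      ∑[ h′ ∈ concatMap extensions (revHists j) ] expect (P h′) w   ≡⟨ ∑-concatMap extensions (revHists j) _ ⟩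
      ∑[ h ∈ revHists j ] ∑[ h′ ∈ extensions h ] expect (P h′) w    ≡⟨ ∑-cong (revHists j) (λ h → ∑-extensions h w) ⟩
      ∑[ h ∈ revHists j ] expect (P h) (λ p → step S h p w)         ∎
      where
      open ≡-Reasoning
      P : History n m → Fin n → ℚ
      P = pathProb M d₀ S

  module _ {d₀ : Fin n → ℚ} (d₀-dist : IsDist d₀) (S : Strategy n m) where

    pathProb-nonneg : ∀ h q → 0ℚ ≤ pathProb M d₀ S h q
    pathProb-nonneg []            q = proj₁ d₀-dist q
    pathProb-nonneg ((p , a) ∷ h) q =
      *-nonneg (*-nonneg (pathProb-nonneg h p) (proj₁ (σ-dist S (reverse h) p) a)) (δ-nonneg p a q)

    distAt-isDist : ∀ j → IsDist (distAt M d₀ S j)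
    distAt-isDist j = (λ q → ∑-nonneg (revHists j) (λ h → pathProb-nonneg h q)) , (begin
      sumFin (distAt M d₀ S j)                        ≡⟨ sumFin≡∑ (distAt M d₀ S j) ⟩
      ∑[ q ∈ allFin n ] distAt M d₀ S j q             ≡⟨ ∑-cong (allFin n) (λ q → sym (*-identityʳ _)) ⟩
      expect (distAt M d₀ S j) (λ _ → 1ℚ)             ≡⟨ total j ⟩
      1ℚ                                              ∎)
      where
      open ≡-Reasoning
      total : ∀ j → expect (distAt M d₀ S j) (λ _ → 1ℚ) ≡ 1ℚ
      total zero    = trans (expect-distAt-zero d₀ S _) (expect-const d₀-dist 1ℚ)
      total (suc j) = begin
        expect (distAt M d₀ S (suc j)) (λ _ → 1ℚ)
          ≡⟨ expect-distAt-suc d₀ S j _ ⟩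
        ∑[ h ∈ revHists j ] expect (pathProb M d₀ S h) (λ p → step S h p (λ _ → 1ℚ))
          ≡⟨ ∑-cong (revHists j) (λ h → expect-cong (pathProb M d₀ S h) (λ p → step-const S h p 1ℚ)) ⟩
        ∑[ h ∈ revHists j ] expect (pathProb M d₀ S h) (λ _ → 1ℚ)
          ≡⟨ sym (expect-distAt d₀ S j _) ⟩
        expect (distAt M d₀ S j) (λ _ → 1ℚ)
          ≡⟨ total j ⟩
        1ℚ
          ∎

    expect-distAt-suc-≥ : ∀ j {v w} → (∀ h p → v p ≤ step S h p w) →
                          expect (distAt M d₀ S j) v ≤ expect (distAt M d₀ S (suc j)) w
    expect-distAt-suc-≥ j {v} {w} v≤step = begin
      expect (distAt M d₀ S j) v
        ≡⟨ expect-distAt d₀ S j v ⟩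
      ∑[ h ∈ revHists j ] expect (pathProb M d₀ S h) v
        ≤⟨ ∑-mono (revHists j) (universal (λ h → expect-mono (pathProb-nonneg h) (v≤step h)) _) ⟩
      ∑[ h ∈ revHists j ] expect (pathProb M d₀ S h) (λ p → step S h p w)
        ≡⟨ expect-distAt-suc d₀ S j w ⟨
      expect (distAt M d₀ S (suc j)) w
        ∎
      where open ≤-Reasoning

    expect-distAt-suc-≤ : ∀ j {v w} → (∀ h → length h ≡ j → ∀ p → step S h p w ≤ v p) →
                          expect (distAt M d₀ S (suc j)) w ≤ expect (distAt M d₀ S j) v
    expect-distAt-suc-≤ j {v} {w} step≤v = begin
      expect (distAt M d₀ S (suc j)) w
        ≡⟨ expect-distAt-suc d₀ S j w ⟩
      ∑[ h ∈ revHists j ] expect (pathProb M d₀ S h) (λ p → step S h p w)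
        ≤⟨ ∑-mono (revHists j) (All.map (λ {h} len → expect-mono (pathProb-nonneg h) (step≤v h len))
                                        (revHists-length j)) ⟩
      ∑[ h ∈ revHists j ] expect (pathProb M d₀ S h) v
        ≡⟨ expect-distAt d₀ S j v ⟨
      expect (distAt M d₀ S j) v
        ∎
      where open ≤-Reasoning

  module _ {d₀ : Fin n → ℚ} (d₀-dist : IsDist d₀) (S : Strategy n m)
           {α : ℚ} (α≥0 : 0ℚ ≤ α) (α-min : ∀ p a q → 0ℚ < δ M p a q → α ≤ δ M p a q) where

    step-𝟙ᶜ-≥ : ∀ h X p → α * 𝟙ᶜ (Pre X) p ≤ step S h p (𝟙ᶜ X)
    step-𝟙ᶜ-≥ h X p with Pre X p in p∈?Pre
    ... | true  = ≤-trans (≤-reflexive (*-zeroʳ α)) (step-≥ S h p (𝟙ᶜ-nonneg X))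
    ... | false = ≤-trans (≤-reflexive (*-identityʳ α))
                    (expect-≥ (σ-dist S (reverse h) p) (λ a → escape a (Pre-false X p p∈?Pre a)))
      where
      escape : ∀ a → ∃ (λ q → X q ≡ false × 0ℚ < δ M p a q) → α ≤ expect (δ M p a) (𝟙ᶜ X)
      escape a (q , q∉X , δ>0) = begin
        α                         ≤⟨ α-min p a q δ>0 ⟩
        δ M p a q                 ≡⟨ trans (cong (δ M p a q *_) (𝟙ᶜ-false X q∉X)) (*-identityʳ _) ⟨
        δ M p a q * 𝟙ᶜ X q        ≤⟨ expect-≥-term (δ-nonneg p a) (𝟙ᶜ-nonneg X) q ⟩
        expect (δ M p a) (𝟙ᶜ X)   ∎
        where open ≤-Reasoning

    expect-𝟙ᶜ-decay : ∀ j X → α ^ℚ j * expect d₀ (𝟙ᶜ (Pre^ j X)) ≤ expect (distAt M d₀ S j) (𝟙ᶜ X)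
    expect-𝟙ᶜ-decay zero    X = ≤-reflexive (trans (*-identityˡ _) (sym (expect-distAt-zero d₀ S _)))
    expect-𝟙ᶜ-decay (suc j) X = begin
      α ^ℚ suc j * expect d₀ (𝟙ᶜ (Pre^ (suc j) X))
        ≡⟨ trans (*-assoc α (α ^ℚ j) _) (cong (λ Y → α * (α ^ℚ j * expect d₀ (𝟙ᶜ Y))) (Pre^-suc j X)) ⟩
      α * (α ^ℚ j * expect d₀ (𝟙ᶜ (Pre^ j (Pre X))))
        ≤⟨ *-monoˡ-≤-0≤ α≥0 (expect-𝟙ᶜ-decay j (Pre X)) ⟩
      α * expect (distAt M d₀ S j) (𝟙ᶜ (Pre X))
        ≡⟨ expect-*ˡ {μ = distAt M d₀ S j} α (𝟙ᶜ (Pre X)) ⟨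
      expect (distAt M d₀ S j) (λ p → α * 𝟙ᶜ (Pre X) p)
        ≤⟨ expect-distAt-suc-≥ d₀-dist S j (λ h → step-𝟙ᶜ-≥ h X) ⟩
      expect (distAt M d₀ S (suc j)) (𝟙ᶜ X)
        ∎
      where open ≤-Reasoning

    escape-bound : ∀ i X q → Pre^ i X q ≡ false → α ^ℚ i * d₀ q ≤ expect (distAt M d₀ S i) (𝟙ᶜ X)
    escape-bound i X q q∉Pre^i = begin
      α ^ℚ i * d₀ q
        ≡⟨ cong (α ^ℚ i *_) (trans (cong (d₀ q *_) (𝟙ᶜ-false (Pre^ i X) q∉Pre^i)) (*-identityʳ (d₀ q))) ⟨
      α ^ℚ i * (d₀ q * 𝟙ᶜ (Pre^ i X) q)
        ≤⟨ *-monoˡ-≤-0≤ (^ℚ-nonneg α≥0 i) (expect-≥-term (proj₁ d₀-dist) (𝟙ᶜ-nonneg (Pre^ i X)) q) ⟩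
      α ^ℚ i * expect d₀ (𝟙ᶜ (Pre^ i X))
        ≤⟨ expect-𝟙ᶜ-decay i X ⟩
      expect (distAt M d₀ S i) (𝟙ᶜ X)
        ∎
      where open ≤-Reasoning

  module _ (a₀ : Fin m) (i : ℕ) (X : Fin n → Bool) where

    countdown : Strategy n m
    countdown = record
      { σ      = λ h p → pointMass (preferredAction a₀ (Pre^ (i ∸ suc (length h)) X) p)
      ; σ-dist = λ h p → pointMass-isDist _
      }

    countdown-step : ∀ h p k → i ∸ suc (length h) ≡ k →
                     step countdown h p (𝟙ᶜ (Pre^ k X)) ≤ 𝟙ᶜ (Pre^ (suc k) X) p
    countdown-step h p k clock with Pre^ (suc k) X p in p∈?Pre
    ... | false = step-≤ countdown h p (𝟙ᶜ-≤1 (Pre^ k X))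
    ... | true  = ≤-reflexive (begin
      step countdown h p (𝟙ᶜ (Pre^ k X))
        ≡⟨ expect-pointMass (action (i ∸ suc (length (reverse h)))) (λ a → expect (δ M p a) (𝟙ᶜ (Pre^ k X))) ⟩
      expect (δ M p (action (i ∸ suc (length (reverse h))))) (𝟙ᶜ (Pre^ k X))
        ≡⟨ cong (λ r → expect (δ M p (action r)) (𝟙ᶜ (Pre^ k X)))
                (trans (cong (λ l → i ∸ suc l) (length-reverse h)) clock) ⟩
      expect (δ M p (action k)) (𝟙ᶜ (Pre^ k X))
        ≡⟨ expect-vanishing (vanish (preferredAction-supp⊆ a₀ (Pre^ k X) p p∈?Pre)) ⟩
      0ℚ
        ∎)
      where
      open ≡-Reasoning
      action : ℕ → Fin m
      action r = preferredAction a₀ (Pre^ r X) p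
      vanish : ∀ {a} → Supp⊆ (Pre^ k X) p a → ∀ q → δ M p a q ≡ 0ℚ ⊎ 𝟙ᶜ (Pre^ k X) q ≡ 0ℚ
      vanish {a} supp⊆ q with supp⊆ q
      ... | inj₁ q∈Pre^k = inj₂ (𝟙ᶜ-true (Pre^ k X) q∈Pre^k)
      ... | inj₂ δ≤0     = inj₁ (≤-antisym δ≤0 (δ-nonneg p a q))

    module _ {d₀ : Fin n → ℚ} (d₀-dist : IsDist d₀) where

      countdown-expect : ∀ j k → j +ℕ k ≡ i →
        expect (distAt M d₀ countdown j) (𝟙ᶜ (Pre^ k X)) ≤ expect d₀ (𝟙ᶜ (Pre^ i X))
      countdown-expect zero k k≡i =
        ≤-reflexive (trans (expect-distAt-zero d₀ countdown _) (cong (λ r → expect d₀ (𝟙ᶜ (Pre^ r X))) k≡i))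
      countdown-expect (suc j) k 1+j+k≡i = ≤-trans
        (expect-distAt-suc-≤ d₀-dist countdown j (λ h len p → countdown-step h p k (clock h len)))
        (countdown-expect j (suc k) (trans (ℕ.+-suc j k) 1+j+k≡i))
        where
        clock : ∀ h → length h ≡ j → i ∸ suc (length h) ≡ k
        clock h len = trans (cong₂ (λ r l → r ∸ suc l) (sym 1+j+k≡i) len) (ℕ.m+n∸m≡n j k)

      countdown-synchronizes : (∀ q → 0ℚ < d₀ q → Pre^ i X q ≡ true) →
                               expect (distAt M d₀ countdown i) (𝟙ᶜ X) ≡ 0ℚ
      countdown-synchronizes supp⊆Pre^i = ≤-antisym
        (≤-trans (countdown-expect i 0 (ℕ.+-identityʳ i)) (≤-reflexive (expect-vanishing vanish)))
        (expect-≥ (distAt-isDist d₀-dist countdown i) (𝟙ᶜ-nonneg X))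
        where
        vanish : ∀ q → d₀ q ≡ 0ℚ ⊎ 𝟙ᶜ (Pre^ i X) q ≡ 0ℚ
        vanish q with 0ℚ <? d₀ q
        ... | yes d₀q>0 = inj₂ (𝟙ᶜ-true (Pre^ i X) (supp⊆Pre^i q d₀q>0))
        ... | no  d₀q≯0 = inj₁ (≤-antisym (≮⇒≥ d₀q≯0) (proj₁ d₀-dist q))

lemma3 : ∀ {n m} (M : MDP n m) (α : ℚ) → IsMinPosTrans M α →
         (T : Subset n) (d₀ : Fin n → ℚ) → IsDist d₀ →
         (α₀ : ℚ) → IsMinPos d₀ α₀ →
         ¬ SureEventuallySync M T d₀ →
         (S : Strategy n m) (i : ℕ) →
         mass (distAt M d₀ S i) T ≤ 1ℚ - α₀ * (α ^ℚ i)
lemma3 {m = m} M α (α>0 , _ , α-min) T d₀ d₀-dist α₀ (_ , (q₀ , _) , α₀-min) ¬sync S i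
  with any? (λ q → (Pre^ M i (_∈ᵇ T) q ≟ᴮ false) ×-dec (0ℚ <? d₀ q))
... | yes (q , q∉Pre^i , d₀q>0) = mass-≤ (distAt-isDist M d₀-dist S i) T (begin
  α₀ * α ^ℚ i                              ≡⟨ *-comm α₀ (α ^ℚ i) ⟩
  α ^ℚ i * α₀                              ≤⟨ *-monoˡ-≤-0≤ (^ℚ-nonneg (<⇒≤ α>0) i) (α₀-min q d₀q>0) ⟩
  α ^ℚ i * d₀ q                            ≤⟨ escape-bound M d₀-dist S (<⇒≤ α>0) α-min i (_∈ᵇ T) q q∉Pre^i ⟩
  expect (distAt M d₀ S i) (𝟙ᶜ (_∈ᵇ T))   ∎)
  where open ≤-Reasoning
... | no ¬escape = contradiction (countdown M a₀ i (_∈ᵇ T) , i , sync) ¬sync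
  where
  a₀ : Fin m
  a₀ = IsDist-inhabited (σ-dist S [] q₀)
  sync : mass (distAt M d₀ (countdown M a₀ i (_∈ᵇ T)) i) T ≡ 1ℚ
  sync = mass-≡1 (distAt-isDist M d₀-dist _ i) T
           (countdown-synchronizes M a₀ i (_∈ᵇ T) d₀-dist
              (λ q d₀q>0 → ¬-not (λ q∉Pre^i → ¬escape (q , q∉Pre^i , d₀q>0))))
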